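{- Let $G$ be a graph and $M$ a perfect matching of $G$. If $M'$ is obtained from $M$ by a matching 2-switch, then $|f(G,M')-f(G,M)|\le 1$.
   Context: For a perfect matching $M$ of $G$, a forcing set for $M$ is a subset $S\subseteq M$ contained in no other perfect matching of $G$; $f(G,M)$ is the minimum size of a forcing set for $M$. A matching 2-switch: if $e_1=\{u_1,v_1\}$ and $e_2=\{u_2,v_2\}$ are edges of $M$ such that $\{u_1,u_2\}$ and $\{v_1,v_2\}$ are edges of $G$ (so $u_1v_1v_2u_2$ is an $M$-alternating $4$-cycle), the matching $M'=(M\setminus\{e_1,e_2\})\cup\{\{u_1,u_2\},\{v_1,v_2\}\}$ is said to be obtained from $M$ by a matching 2-switch. -}

module Defs where

open import Level using (0ℓ)
open import Data.Nat using (ℕ; _*_; _≤_)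
open import Data.Fin using (Fin)
open import Data.Fin.Subset using (Subset; _∈_; _∉_; ∣_∣)
import Data.Empty
open import Data.Product using (_×_; ∃)
open import Relation.Binary.PropositionalEquality using (_≡_; _≢_)

record Graph (n : ℕ) : Set₁ where
  field
    Adj   : Fin n → Fin n → Set
    sym   : ∀ {u v} → Adj u v → Adj v u
    irrefl : ∀ {u} → Adj u u → Data.Empty.⊥
open Graph public

-- A perfect matching M of G, encoded by its partner map m : every vertex v is
-- covered by exactly one edge {v, m v} of M, which is an edge of G.
record PerfectMatching {n : ℕ} (G : Graph n) : Set where
  field
    mate     : Fin n → Fin n
    mate-adj : ∀ v → Adj G v (mate v)
    mate-inv : ∀ v → mate (mate v) ≡ v
open PerfectMatching public

-- A subset S ⊆ M of edges of M is encoded by the set of vertices it covers,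
-- i.e. a vertex set closed under the partner map.  S has |S|/2 edges.
EdgeSubsetOf : ∀ {n} {G : Graph n} → PerfectMatching G → Subset n → Set
EdgeSubsetOf M S = ∀ v → v ∈ S → mate M v ∈ S

HasEdgeCount : ∀ {n} → Subset n → ℕ → Set
HasEdgeCount S k = ∣ S ∣ ≡ 2 * k

IsForcingSet : ∀ {n} (G : Graph n) → PerfectMatching G → Subset n → Set
IsForcingSet G M S =
  EdgeSubsetOf M S ×
  (∀ (M′ : PerfectMatching G) →
     (∀ v → v ∈ S → mate M′ v ≡ mate M v) →
     ∀ v → mate M′ v ≡ mate M v)

ForcingNumber : ∀ {n} (G : Graph n) → PerfectMatching G → ℕ → Set
ForcingNumber G M k =
  (∃ λ S → IsForcingSet G M S × HasEdgeCount S k) ×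
  (∀ S j → IsForcingSet G M S → HasEdgeCount S j → k ≤ j)

-- M′ is obtained from M by a matching 2-switch: e₁ = {u₁,v₁}, e₂ = {u₂,v₂}
-- distinct edges of M, {u₁,u₂},{v₁,v₂} ∈ E(G), and
-- M′ = (M ∖ {e₁,e₂}) ∪ {{u₁,u₂},{v₁,v₂}}.
TwoSwitch : ∀ {n} (G : Graph n) → PerfectMatching G → PerfectMatching G → Set
TwoSwitch G M M′ =
  ∃ λ u₁ → ∃ λ v₁ → ∃ λ u₂ → ∃ λ v₂ →
    (mate M u₁ ≡ v₁) × (mate M u₂ ≡ v₂) ×
    (u₂ ≢ u₁) × (u₂ ≢ v₁) ×
    Adj G u₁ u₂ × Adj G v₁ v₂ ×
    (mate M′ u₁ ≡ u₂) × (mate M′ v₁ ≡ v₂) ×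
    (∀ w → w ≢ u₁ → w ≢ v₁ → w ≢ u₂ → w ≢ v₂ → mate M′ w ≡ mate M w)

-- A forcing set S of M must meet the alternating 4-cycle u₁v₁v₂u₂ of the switch, since
-- otherwise M′ would agree with M on S and hence equal M.  Adding to S the at most one
-- switched edge it misses gives a set X ⊇ S, closed under M, outside which M′ = M.
-- Such an X forces M′: if a perfect matching N agrees with M′ on X, the matching that
-- is M on X and N off X agrees with M on S, hence equals M, so N = M = M′ off X too.
-- Hence f(G,M′) ≤ f(G,M) + 1, and the converse follows because 2-switches are symmetric.
module Submission where

open import Defs hiding (sym)
open import Data.Nat using (ℕ; zero; suc; _≤_; s≤s; ∣_-_∣)
open import Data.Nat.Properties using (≤-trans; ≤-refl; n≤1+n; *-suc)
open import Data.Fin using (Fin; zero; suc)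
open import Data.Fin.Subset using (Subset; _∈_; _∉_; ∣_∣; _∪_; ⁅_⁆; _⊆_; inside; outside)
open import Data.Fin.Subset.Properties using (_∈?_; x∈p∪q⁻; x∈p∪q⁺; x∈⁅x⁆; x∈⁅y⁆⇒x≡y; ∪-identityʳ)
open import Data.Vec using (_∷_; here; there)
open import Data.Product using (_,_)
open import Data.Sum using (_⊎_; inj₁; inj₂)
open import Data.Empty using (⊥-elim)
open import Relation.Nullary using (yes; no; Dec)
open import Relation.Binary.PropositionalEquality
  using (_≡_; _≢_; refl; sym; trans; cong; subst; module ≡-Reasoning)

∣m-n∣≤1 : ∀ m n → m ≤ suc n → n ≤ suc m → ∣ m - n ∣ ≤ 1
∣m-n∣≤1 zero    n       _         n≤1 = n≤1
∣m-n∣≤1 (suc m) zero    m≤0       _   = m≤0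
∣m-n∣≤1 (suc m) (suc n) (s≤s m≤n) (s≤s n≤m) = ∣m-n∣≤1 m n m≤n n≤m

∣p∪⁅x⁆∣≡1+∣p∣ : ∀ {n} (p : Subset n) (x : Fin n) → x ∉ p → ∣ p ∪ ⁅ x ⁆ ∣ ≡ suc ∣ p ∣
∣p∪⁅x⁆∣≡1+∣p∣ (outside ∷ p) zero    _   = cong suc (cong ∣_∣ (∪-identityʳ p))
∣p∪⁅x⁆∣≡1+∣p∣ (inside  ∷ p) zero    x∉p = ⊥-elim (x∉p here)
∣p∪⁅x⁆∣≡1+∣p∣ (outside ∷ p) (suc x) x∉p = ∣p∪⁅x⁆∣≡1+∣p∣ p x (λ x∈p → x∉p (there x∈p))
∣p∪⁅x⁆∣≡1+∣p∣ (inside  ∷ p) (suc x) x∉p = cong suc (∣p∪⁅x⁆∣≡1+∣p∣ p x (λ x∈p → x∉p (there x∈p)))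

module _ {n : ℕ} {G : Graph n} where

  mate-sym : (M : PerfectMatching G) {a b : Fin n} → mate M a ≡ b → mate M b ≡ a
  mate-sym M {a} refl = mate-inv M a

  mate-irrefl : (M : PerfectMatching G) (a : Fin n) → mate M a ≢ a
  mate-irrefl M a eq = irrefl G (subst (Adj G a) eq (mate-adj M a))

  ∉-closed : (M : PerfectMatching G) {X : Subset n} → EdgeSubsetOf M X →
             ∀ {w} → w ∉ X → mate M w ∉ X
  ∉-closed M X-closed {w} w∉X mw∈X = w∉X (subst (_∈ _) (mate-inv M w) (X-closed _ mw∈X))

  closed-if-agree-inside : {M N : PerfectMatching G} {X : Subset n} → EdgeSubsetOf M X →
    (∀ v → v ∈ X → mate N v ≡ mate M v) → EdgeSubsetOf N X
  closed-if-agree-inside X-closed agree v v∈X =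
    subst (_∈ _) (sym (agree v v∈X)) (X-closed v v∈X)

  closed-if-agree-outside : {M N : PerfectMatching G} {X : Subset n} → EdgeSubsetOf M X →
    (∀ v → v ∉ X → mate N v ≡ mate M v) → EdgeSubsetOf N X
  closed-if-agree-outside {M} {N} {X} X-closed agree v v∈X with mate N v ∈? X
  ... | yes nv∈X = nv∈X
  ... | no  nv∉X = ⊥-elim (nv∉X (subst (_∈ X) (sym nv≡mv) (X-closed v v∈X)))
    where
      nv≡mv : mate N v ≡ mate M v
      nv≡mv = sym (mate-sym M (trans (sym (agree _ nv∉X)) (mate-inv N v)))

  module Splice (M N : PerfectMatching G) (X : Subset n)
                (M-closed : EdgeSubsetOf M X) (N-closed : EdgeSubsetOf N X) where

    choose : ∀ v → Dec (v ∈ X) → Fin n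
    choose v (yes _) = mate M v
    choose v (no  _) = mate N v

    splice-mate : Fin n → Fin n
    splice-mate v = choose v (v ∈? X)

    splice-∈ : ∀ {v} → v ∈ X → splice-mate v ≡ mate M v
    splice-∈ {v} v∈X with v ∈? X
    ... | yes _   = refl
    ... | no  v∉X = ⊥-elim (v∉X v∈X)

    splice-∉ : ∀ {v} → v ∉ X → splice-mate v ≡ mate N v
    splice-∉ {v} v∉X with v ∈? X
    ... | yes v∈X = ⊥-elim (v∉X v∈X)
    ... | no  _   = refl

    splice-adj : ∀ v → Dec (v ∈ X) → Adj G v (splice-mate v)
    splice-adj v (yes v∈X) = subst (Adj G v) (sym (splice-∈ v∈X)) (mate-adj M v)
    splice-adj v (no  v∉X) = subst (Adj G v) (sym (splice-∉ v∉X)) (mate-adj N v)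

    splice-inv : ∀ v → Dec (v ∈ X) → splice-mate (splice-mate v) ≡ v
    splice-inv v (yes v∈X) = begin
      splice-mate (splice-mate v) ≡⟨ cong splice-mate (splice-∈ v∈X) ⟩
      splice-mate (mate M v)      ≡⟨ splice-∈ (M-closed v v∈X) ⟩
      mate M (mate M v)           ≡⟨ mate-inv M v ⟩
      v                           ∎
      where open ≡-Reasoning
    splice-inv v (no v∉X) = begin
      splice-mate (splice-mate v) ≡⟨ cong splice-mate (splice-∉ v∉X) ⟩
      splice-mate (mate N v)      ≡⟨ splice-∉ (∉-closed N N-closed v∉X) ⟩
      mate N (mate N v)           ≡⟨ mate-inv N v ⟩
      v                           ∎
      where open ≡-Reasoning

    splice : PerfectMatching G
    splice = record
      { mate     = splice-mate
      ; mate-adj = λ v → splice-adj v (v ∈? X)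
      ; mate-inv = λ v → splice-inv v (v ∈? X)
      }

  forcingSet-transfer : {M M′ : PerfectMatching G} {S X : Subset n} →
    IsForcingSet G M S → S ⊆ X → EdgeSubsetOf M X →
    (∀ w → w ∉ X → mate M′ w ≡ mate M w) → IsForcingSet G M′ X
  forcingSet-transfer {M} {M′} {S} {X} (_ , S-forces) S⊆X X-closed unchanged =
    X-closed′ , X-forces
    where
      X-closed′ : EdgeSubsetOf M′ X
      X-closed′ = closed-if-agree-outside {M} {M′} X-closed unchanged

      X-forces : ∀ N → (∀ v → v ∈ X → mate N v ≡ mate M′ v) → ∀ v → mate N v ≡ mate M′ v
      X-forces N agree v with v ∈? X
      ... | yes v∈X = agree v v∈X
      ... | no  v∉X = begin
        mate N v            ≡⟨ sym (splice-∉ v∉X) ⟩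
        mate splice v       ≡⟨ S-forces splice (λ w w∈S → splice-∈ (S⊆X w∈S)) v ⟩
        mate M v            ≡⟨ sym (unchanged v v∉X) ⟩
        mate M′ v           ∎
        where
          open Splice M N X X-closed (closed-if-agree-inside {M′} {N} X-closed′ agree)
          open ≡-Reasoning

  record EdgeExtension (M : PerfectMatching G) (S : Subset n) (k : ℕ) (a : Fin n) : Set where
    field
      set    : Subset n
      edges  : ℕ
      ⊇S     : S ⊆ set
      ∋a     : a ∈ set
      closed : EdgeSubsetOf M set
      count  : HasEdgeCount set edges
      edges≤ : edges ≤ suc k

  module AddEdge (M : PerfectMatching G) (S : Subset n) (a : Fin n) where

    S+a : Subset n
    S+a = (S ∪ ⁅ a ⁆) ∪ ⁅ mate M a ⁆

    S⊆S+a : S ⊆ S+a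
    S⊆S+a w∈S = x∈p∪q⁺ (inj₁ (x∈p∪q⁺ (inj₁ w∈S)))

    a∈S+a : a ∈ S+a
    a∈S+a = x∈p∪q⁺ (inj₁ (x∈p∪q⁺ (inj₂ (x∈⁅x⁆ a))))

    ma∈S+a : mate M a ∈ S+a
    ma∈S+a = x∈p∪q⁺ (inj₂ (x∈⁅x⁆ (mate M a)))

    S+a-closed : EdgeSubsetOf M S → EdgeSubsetOf M S+a
    S+a-closed S-closed w w∈S+a with x∈p∪q⁻ (S ∪ ⁅ a ⁆) ⁅ mate M a ⁆ w∈S+a
    ... | inj₂ w∈⁅ma⁆ rewrite x∈⁅y⁆⇒x≡y (mate M a) w∈⁅ma⁆ =
      subst (_∈ S+a) (sym (mate-inv M a)) a∈S+a
    ... | inj₁ w∈S∪⁅a⁆ with x∈p∪q⁻ S ⁅ a ⁆ w∈S∪⁅a⁆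
    ... | inj₁ w∈S   = S⊆S+a (S-closed w w∈S)
    ... | inj₂ w∈⁅a⁆ rewrite x∈⁅y⁆⇒x≡y a w∈⁅a⁆ = ma∈S+a

    ∣S+a∣≡2+∣S∣ : EdgeSubsetOf M S → a ∉ S → ∣ S+a ∣ ≡ suc (suc ∣ S ∣)
    ∣S+a∣≡2+∣S∣ S-closed a∉S =
      trans (∣p∪⁅x⁆∣≡1+∣p∣ (S ∪ ⁅ a ⁆) (mate M a) ma∉S∪⁅a⁆)
            (cong suc (∣p∪⁅x⁆∣≡1+∣p∣ S a a∉S))
      where
        ma∉S∪⁅a⁆ : mate M a ∉ S ∪ ⁅ a ⁆
        ma∉S∪⁅a⁆ ma∈ with x∈p∪q⁻ S ⁅ a ⁆ ma∈
        ... | inj₁ ma∈S   = ∉-closed M S-closed a∉S ma∈S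
        ... | inj₂ ma∈⁅a⁆ = mate-irrefl M a (x∈⁅y⁆⇒x≡y a ma∈⁅a⁆)

  extend-by-edge : (M : PerfectMatching G) {S : Subset n} {k : ℕ} →
    EdgeSubsetOf M S → HasEdgeCount S k → ∀ a → EdgeExtension M S k a
  extend-by-edge M {S} {k} S-closed ∣S∣≡2k a with a ∈? S
  ... | yes a∈S = record
    { set = S ; edges = k ; ⊇S = λ w∈S → w∈S ; ∋a = a∈S
    ; closed = S-closed ; count = ∣S∣≡2k ; edges≤ = n≤1+n k }
  ... | no a∉S = record
    { set = S+a ; edges = suc k ; ⊇S = S⊆S+a ; ∋a = a∈S+a
    ; closed = S+a-closed S-closed
    ; count = trans (∣S+a∣≡2+∣S∣ S-closed a∉S)
                    (trans (cong (λ c → suc (suc c)) ∣S∣≡2k) (sym (*-suc 2 k)))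
    ; edges≤ = ≤-refl }
    where open AddEdge M S a

  module Switched (M M′ : PerfectMatching G) {u₁ v₁ u₂ v₂ : Fin n}
    (u₁v₁∈M : mate M u₁ ≡ v₁) (u₂v₂∈M : mate M u₂ ≡ v₂)
    (unchanged : ∀ w → w ≢ u₁ → w ≢ v₁ → w ≢ u₂ → w ≢ v₂ → mate M′ w ≡ mate M w)
    {X : Subset n} (X-closed : EdgeSubsetOf M X) where

    private
      ∉∈⇒≢ : ∀ {w a} → w ∉ X → a ∈ X → w ≢ a
      ∉∈⇒≢ w∉X a∈X refl = w∉X a∈X

      ∈∉⇒≢ : ∀ {w a} → w ∈ X → a ∉ X → w ≢ a
      ∈∉⇒≢ w∈X a∉X refl = a∉X w∈X

    unchanged-outside : u₁ ∈ X → u₂ ∈ X → ∀ w → w ∉ X → mate M′ w ≡ mate M w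
    unchanged-outside u₁∈X u₂∈X w w∉X = unchanged w
      (∉∈⇒≢ w∉X u₁∈X) (∉∈⇒≢ w∉X (subst (_∈ X) u₁v₁∈M (X-closed u₁ u₁∈X)))
      (∉∈⇒≢ w∉X u₂∈X) (∉∈⇒≢ w∉X (subst (_∈ X) u₂v₂∈M (X-closed u₂ u₂∈X)))

    unchanged-inside : u₁ ∉ X → u₂ ∉ X → ∀ w → w ∈ X → mate M′ w ≡ mate M w
    unchanged-inside u₁∉X u₂∉X w w∈X = unchanged w
      (∈∉⇒≢ w∈X u₁∉X) (∈∉⇒≢ w∈X (subst (_∉ X) u₁v₁∈M (∉-closed M X-closed u₁∉X)))
      (∈∉⇒≢ w∈X u₂∉X) (∈∉⇒≢ w∈X (subst (_∉ X) u₂v₂∈M (∉-closed M X-closed u₂∉X)))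

  record ForcingSetBound (M : PerfectMatching G) (k : ℕ) : Set where
    field
      set     : Subset n
      edges   : ℕ
      forcing : IsForcingSet G M set
      count   : HasEdgeCount set edges
      edges≤  : edges ≤ k

  forcingSet-after-switch : (M M′ : PerfectMatching G) {S : Subset n} {k : ℕ} →
    TwoSwitch G M M′ → IsForcingSet G M S → HasEdgeCount S k → ForcingSetBound M′ (suc k)
  forcingSet-after-switch M M′ {S} {k}
    (u₁ , v₁ , u₂ , v₂ , u₁v₁∈M , u₂v₂∈M , _ , u₂≢v₁ , _ , _ , u₁u₂∈M′ , _ , unchanged)
    S-forcing@(S-closed , S-forces) ∣S∣≡2k = bound-from S-meets-switch
    where
      covering-bound : ∀ {a} (E : EdgeExtension M S k a) → let open EdgeExtension E in
        u₁ ∈ set → u₂ ∈ set → ForcingSetBound M′ (suc k)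
      covering-bound E u₁∈E u₂∈E = record
        { set = set ; edges = edges ; count = count ; edges≤ = edges≤
        ; forcing = forcingSet-transfer {M} {M′} S-forcing ⊇S closed
            (Switched.unchanged-outside M M′ u₁v₁∈M u₂v₂∈M unchanged closed u₁∈E u₂∈E) }
        where open EdgeExtension E

      S-meets-switch : u₁ ∈ S ⊎ u₂ ∈ S
      S-meets-switch with u₁ ∈? S | u₂ ∈? S
      ... | yes u₁∈S | _        = inj₁ u₁∈S
      ... | no  _    | yes u₂∈S = inj₂ u₂∈S
      ... | no  u₁∉S | no  u₂∉S = ⊥-elim (u₂≢v₁ (begin
        u₂          ≡⟨ sym u₁u₂∈M′ ⟩
        mate M′ u₁  ≡⟨ S-forces M′ M′-agrees-on-S u₁ ⟩
        mate M u₁   ≡⟨ u₁v₁∈M ⟩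
        v₁          ∎))
        where
          open ≡-Reasoning
          M′-agrees-on-S : ∀ w → w ∈ S → mate M′ w ≡ mate M w
          M′-agrees-on-S =
            Switched.unchanged-inside M M′ u₁v₁∈M u₂v₂∈M unchanged S-closed u₁∉S u₂∉S

      bound-from : u₁ ∈ S ⊎ u₂ ∈ S → ForcingSetBound M′ (suc k)
      bound-from (inj₁ u₁∈S) = covering-bound E (EdgeExtension.⊇S E u₁∈S) (EdgeExtension.∋a E)
        where
          E : EdgeExtension M S k u₂
          E = extend-by-edge M S-closed ∣S∣≡2k u₂
      bound-from (inj₂ u₂∈S) = covering-bound E (EdgeExtension.∋a E) (EdgeExtension.⊇S E u₂∈S)
        where
          E : EdgeExtension M S k u₁
          E = extend-by-edge M S-closed ∣S∣≡2k u₁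

  TwoSwitch-sym : (M M′ : PerfectMatching G) → TwoSwitch G M M′ → TwoSwitch G M′ M
  TwoSwitch-sym M M′
    (u₁ , v₁ , u₂ , v₂ , u₁v₁∈M , u₂v₂∈M , _ , u₂≢v₁ , _ , _ , u₁u₂∈M′ , v₁v₂∈M′ , unchanged) =
    u₁ , u₂ , v₁ , v₂ , u₁u₂∈M′ , v₁v₂∈M′ ,
    (λ v₁≡u₁ → mate-irrefl M u₁ (trans u₁v₁∈M v₁≡u₁)) ,
    (λ v₁≡u₂ → u₂≢v₁ (sym v₁≡u₂)) ,
    subst (Adj G u₁) u₁v₁∈M (mate-adj M u₁) ,
    subst (Adj G u₂) u₂v₂∈M (mate-adj M u₂) ,
    u₁v₁∈M , u₂v₂∈M ,
    (λ w w≢u₁ w≢u₂ w≢v₁ w≢v₂ → sym (unchanged w w≢u₁ w≢v₁ w≢u₂ w≢v₂))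

  forcingNumber-after-switch-≤ : (M M′ : PerfectMatching G) {k k′ : ℕ} → TwoSwitch G M M′ →
    ForcingNumber G M k → ForcingNumber G M′ k′ → k′ ≤ suc k
  forcingNumber-after-switch-≤ M M′ {k} switch ((S , S-forcing , ∣S∣≡2k) , _) (_ , k′-minimal) =
    ≤-trans (k′-minimal set edges forcing count) edges≤
    where open ForcingSetBound (forcingSet-after-switch M M′ {k = k} switch S-forcing ∣S∣≡2k)

mainTheorem4 : ∀ {n} (G : Graph n) (M M′ : PerfectMatching G) (k k′ : ℕ) →
    TwoSwitch G M M′ → ForcingNumber G M k → ForcingNumber G M′ k′ →
    ∣ k′ - k ∣ ≤ 1
mainTheorem4 G M M′ k k′ switch f f′ =
  ∣m-n∣≤1 k′ k (forcingNumber-after-switch-≤ M M′ switch f f′)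
               (forcingNumber-after-switch-≤ M′ M (TwoSwitch-sym M M′ switch) f′ f)
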